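{- Let $X=\{0\}\cup\{x\in\mathbb Q:1\le x\le 2\}\cup\{3\}$ with the order inherited from $\mathbb Q$, and for a linear order $L$ let $f(L)=L\times X$ with the lexicographic order. For any linear orders $L_1,L_2$, $L_1\cong L_2$ if and only if $f(L_1)\cong f(L_2)$. -}

module Defs where

open import Level using (Level; _⊔_; suc)
open import Data.Product using (Σ; _×_; _,_; proj₁)
open import Data.Sum using (_⊎_)
open import Data.Integer using (+_)
open import Data.Rational as ℚ using (ℚ; 0ℚ; 1ℚ; _/_)
open import Relation.Binary.Core using (Rel)
open import Relation.Binary.Structures using (IsStrictTotalOrder)
open import Relation.Binary.PropositionalEquality using (_≡_)
open import Function.Bundles using (_↔_; Inverse)

record LinOrd (ℓ : Level) : Set (suc ℓ) where
  field
    Carrier : Set ℓ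
    _<_     : Rel Carrier ℓ
    isStrictTotalOrder : IsStrictTotalOrder _≡_ _<_

record OrdSet (ℓ : Level) : Set (suc ℓ) where
  constructor ordSet
  field
    Carrier : Set ℓ
    _<_     : Rel Carrier ℓ

toOrdSet : ∀ {ℓ} → LinOrd ℓ → OrdSet ℓ
toOrdSet L = ordSet (LinOrd.Carrier L) (LinOrd._<_ L)

_≅_ : ∀ {a b} → OrdSet a → OrdSet b → Set (a ⊔ b)
A ≅ B = Σ (OrdSet.Carrier A ↔ OrdSet.Carrier B) λ φ →
  ∀ x y → (OrdSet._<_ A x y → OrdSet._<_ B (Inverse.to φ x) (Inverse.to φ y))
        × (OrdSet._<_ B (Inverse.to φ x) (Inverse.to φ y) → OrdSet._<_ A x y)

2ℚ 3ℚ : ℚ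
2ℚ = + 2 / 1
3ℚ = + 3 / 1

InX : ℚ → Set
InX q = (q ≡ 0ℚ) ⊎ ((1ℚ ℚ.≤ q × q ℚ.≤ 2ℚ) ⊎ (q ≡ 3ℚ))

X : Set
X = Σ ℚ InX

_<X_ : Rel X Level.zero
x <X y = proj₁ x ℚ.< proj₁ y

f : ∀ {ℓ} → LinOrd ℓ → OrdSet ℓ
f L = ordSet (Carrier × X) _<lex_
  where
    open LinOrd L
    _<lex_ : Rel (Carrier × X) _
    (a , x) <lex (b , y) = (a < b) ⊎ ((a ≡ b) × (x <X y))

module Submission where

-- The forward direction is immediate: an isomorphism L₁ ≅ L₂ acts on the first
-- coordinate of L × X.  For the converse we single out, purely in terms of the
-- order, the points (a , 0) of f L.  Call v "smooth" if it has neither an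
-- immediate successor nor an immediate predecessor, and call x a "block start"
-- if x has an immediate successor y followed by a nonempty open interval (y , z)
-- of smooth points.  In f L the points (a , 0) are block starts (successor
-- (a , 1), interval ((a , 1) , (a , 2)) ⊆ {a} × (1 , 2)), and no other point is:
-- (a , t) with 1 ≤ t < 2 has no successor, the successor of (a , 2) is (a , 3)
-- and every interval after it contains some (e , 0), and the successor of
-- (a , 3) is some (c , 0) and every interval after it contains (c , 1).
--
-- Consequently every
-- isomorphism f L₁ ≅ f L₂ maps the copy {(a , 0)} of L₁ onto the copy of L₂, and
-- restricting it there gives L₁ ≅ L₂.

open import Defs
open import Level using (Level)
open import Data.Product using (Σ; _×_; _,_; proj₁; proj₂)
open import Data.Sum using (inj₁; inj₂)
open import Data.Empty using (⊥; ⊥-elim)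
open import Data.Unit using (tt)
open import Data.Integer using (+_)
open import Data.Rational as ℚ using (ℚ; 0ℚ; 1ℚ; _/_)
import Data.Rational.Properties as ℚP
open import Relation.Nullary using (¬_; yes; no)
open import Relation.Nullary.Decidable using (toWitness)
open import Relation.Binary.PropositionalEquality
open import Relation.Binary.Structures using (IsStrictTotalOrder)
open import Function.Bundles using (Inverse; mk↔ₛ′)

module _ {ℓ : Level} (A : OrdSet ℓ) where
  open OrdSet A

  Succ : Carrier → Carrier → Set ℓ
  Succ x y = (x < y) × (∀ v → x < v → v < y → ⊥)

  Smooth : Carrier → Set ℓ
  Smooth v = (∀ s → ¬ Succ v s) × (∀ p → ¬ Succ p v)

  BlockStart : Carrier → Set ℓ
  BlockStart x = Σ Carrier λ y → Σ Carrier λ w → Σ Carrier λ z →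
    Succ x y × (y < w) × (w < z) × (∀ v → y < v → v < z → Smooth v)

module Iso {a b} (A : OrdSet a) (B : OrdSet b) (φ : A ≅ B) where
  open OrdSet A using () renaming (_<_ to _<A_)
  open OrdSet B using () renaming (_<_ to _<B_)
  open Inverse (proj₁ φ) public using (to; from; strictlyInverseˡ; strictlyInverseʳ)

  preserves : ∀ {x y} → x <A y → to x <B to y
  preserves {x} {y} = proj₁ (proj₂ φ x y)

  reflects : ∀ {x y} → to x <B to y → x <A y
  reflects {x} {y} = proj₂ (proj₂ φ x y)

  from-preserves : ∀ {u v} → u <B v → from u <A from v
  from-preserves {u} {v} u<v =
    reflects (subst₂ _<B_ (sym (strictlyInverseˡ u)) (sym (strictlyInverseˡ v)) u<v)

  from-above : ∀ {x v} → to x <B v → x <A from v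
  from-above {x} {v} x<v = subst (_<A from v) (strictlyInverseʳ x) (from-preserves x<v)

  from-below : ∀ {v y} → v <B to y → from v <A y
  from-below {v} {y} v<y = subst (from v <A_) (strictlyInverseʳ y) (from-preserves v<y)

≅-sym : ∀ {a b} {A : OrdSet a} {B : OrdSet b} → A ≅ B → B ≅ A
≅-sym {A = A} {B = B} φ =
  mk↔ₛ′ from to strictlyInverseʳ strictlyInverseˡ ,
  λ u v → from-preserves ,
          λ lt → subst₂ (OrdSet._<_ B) (strictlyInverseˡ u) (strictlyInverseˡ v) (preserves lt)
  where open Iso A B φ

Succ-preserved : ∀ {a b} {A : OrdSet a} {B : OrdSet b} (φ : A ≅ B) →
  ∀ {x y} → Succ A x y → Succ B (Iso.to A B φ x) (Iso.to A B φ y)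
Succ-preserved {A = A} {B} φ (x<y , empty) =
  preserves x<y , λ v x<v v<y → empty (from v) (from-above x<v) (from-below v<y)
  where open Iso A B φ

Smooth-preserved : ∀ {a b} {A : OrdSet a} {B : OrdSet b} (φ : A ≅ B) →
  ∀ {v} → Smooth A v → Smooth B (Iso.to A B φ v)
Smooth-preserved {A = A} {B} φ {v} (noSucc , noPred) =
  (λ s vs → noSucc (from s) (subst (λ u → Succ A u (from s)) (strictlyInverseʳ v) (pull-back vs))) ,
  (λ p pv → noPred (from p) (subst (Succ A (from p)) (strictlyInverseʳ v) (pull-back pv)))
  where
    open Iso A B φ
    pull-back : ∀ {u u'} → Succ B u u' → Succ A (from u) (from u')
    pull-back = Succ-preserved {A = B} {A} (≅-sym φ)

BlockStart-preserved : ∀ {a b} {A : OrdSet a} {B : OrdSet b} (φ : A ≅ B) →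
  ∀ {x} → BlockStart A x → BlockStart B (Iso.to A B φ x)
BlockStart-preserved {A = A} {B} φ (y , w , z , xy , y<w , w<z , smooth) =
  to y , to w , to z , Succ-preserved {A = A} {B} φ xy , preserves y<w , preserves w<z ,
  λ v y<v v<z → subst (Smooth B) (strictlyInverseˡ v)
    (Smooth-preserved {A = A} {B} φ (smooth (from v) (from-above y<v) (from-below v<z)))
  where open Iso A B φ

0<1 : 0ℚ ℚ.< 1ℚ
0<1 = toWitness {a? = 0ℚ ℚ.<? 1ℚ} tt

1<2 : 1ℚ ℚ.< 2ℚ
1<2 = toWitness {a? = 1ℚ ℚ.<? 2ℚ} tt

2<3 : 2ℚ ℚ.< 3ℚ
2<3 = toWitness {a? = 2ℚ ℚ.<? 3ℚ} tt

0<3 : 0ℚ ℚ.< 3ℚ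
0<3 = ℚP.<-trans 0<1 (ℚP.<-trans 1<2 2<3)

inner : ∀ q → 1ℚ ℚ.≤ q → q ℚ.≤ 2ℚ → X
inner q 1≤q q≤2 = q , inj₂ (inj₁ (1≤q , q≤2))

x0 x1 x2 x3 : X
x0 = 0ℚ , inj₁ refl
x1 = inner 1ℚ ℚP.≤-refl (ℚP.<⇒≤ 1<2)
x2 = inner 2ℚ (ℚP.<⇒≤ 1<2) ℚP.≤-refl
x3 = 3ℚ , inj₂ (inj₂ refl)

xMid : X
xMid = let (m , 1<m , m<2) = ℚP.<-dense 1<2 in inner m (ℚP.<⇒≤ 1<m) (ℚP.<⇒≤ m<2)

1<xMid : 1ℚ ℚ.< proj₁ xMid
1<xMid = proj₁ (proj₂ (ℚP.<-dense 1<2))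

xMid<2 : proj₁ xMid ℚ.< 2ℚ
xMid<2 = proj₂ (proj₂ (ℚP.<-dense 1<2))

X-min : (s : X) → 0ℚ ℚ.≤ proj₁ s
X-min (_ , inj₁ refl) = ℚP.≤-refl
X-min (_ , inj₂ (inj₁ (1≤s , _))) = ℚP.≤-trans (ℚP.<⇒≤ 0<1) 1≤s
X-min (_ , inj₂ (inj₂ refl)) = ℚP.<⇒≤ 0<3

X-max : (s : X) → ¬ (3ℚ ℚ.< proj₁ s)
X-max (_ , inj₁ refl) 3<0 = ℚP.<-asym 3<0 0<3
X-max (_ , inj₂ (inj₁ (_ , s≤2))) 3<s = ℚP.<-asym (ℚP.≤-<-trans s≤2 2<3) 3<s
X-max (_ , inj₂ (inj₂ refl)) 3<3 = ℚP.<-irrefl refl 3<3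

gap01 : (s : X) → 0ℚ ℚ.< proj₁ s → 1ℚ ℚ.≤ proj₁ s
gap01 (_ , inj₁ refl) 0<0 = ⊥-elim (ℚP.<-irrefl refl 0<0)
gap01 (_ , inj₂ (inj₁ (1≤s , _))) _ = 1≤s
gap01 (_ , inj₂ (inj₂ refl)) _ = ℚP.<⇒≤ (ℚP.<-trans 1<2 2<3)

gap23 : (s : X) → 2ℚ ℚ.< proj₁ s → s ≡ x3
gap23 (_ , inj₁ refl) 2<0 = ⊥-elim (ℚP.<-asym 2<0 (ℚP.<-trans 0<1 1<2))
gap23 (_ , inj₂ (inj₁ (_ , s≤2))) 2<s = ⊥-elim (ℚP.<-irrefl refl (ℚP.<-≤-trans 2<s s≤2))
gap23 (_ , inj₂ (inj₂ refl)) _ = refl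

dense-above : (t : ℚ) (u : X) → 1ℚ ℚ.≤ t → t ℚ.< 2ℚ → t ℚ.< proj₁ u →
  Σ X λ m → (t ℚ.< proj₁ m) × (proj₁ m ℚ.< proj₁ u)
dense-above t (_ , inj₁ refl) 1≤t _ t<0 = ⊥-elim (ℚP.<-asym t<0 (ℚP.<-≤-trans 0<1 1≤t))
dense-above t (u , inj₂ (inj₁ (_ , u≤2))) 1≤t _ t<u =
  let (m , t<m , m<u) = ℚP.<-dense t<u in
  inner m (ℚP.<⇒≤ (ℚP.≤-<-trans 1≤t t<m)) (ℚP.<⇒≤ (ℚP.<-≤-trans m<u u≤2)) , t<m , m<u
dense-above t (_ , inj₂ (inj₂ refl)) 1≤t t<2 _ =
  let (m , t<m , m<2) = ℚP.<-dense t<2 in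
  inner m (ℚP.<⇒≤ (ℚP.≤-<-trans 1≤t t<m)) (ℚP.<⇒≤ m<2) , t<m , ℚP.<-trans m<2 2<3

dense-below : (t : ℚ) (u : X) → 1ℚ ℚ.< t → t ℚ.≤ 2ℚ → proj₁ u ℚ.< t →
  Σ X λ m → (proj₁ u ℚ.< proj₁ m) × (proj₁ m ℚ.< t)
dense-below t (_ , inj₁ refl) 1<t t≤2 _ =
  let (m , 1<m , m<t) = ℚP.<-dense 1<t in
  inner m (ℚP.<⇒≤ 1<m) (ℚP.<⇒≤ (ℚP.<-≤-trans m<t t≤2)) , ℚP.<-trans 0<1 1<m , m<t
dense-below t (u , inj₂ (inj₁ (1≤u , _))) _ t≤2 u<t =
  let (m , u<m , m<t) = ℚP.<-dense u<t in
  inner m (ℚP.<⇒≤ (ℚP.≤-<-trans 1≤u u<m)) (ℚP.<⇒≤ (ℚP.<-≤-trans m<t t≤2)) , u<m , m<t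
dense-below t (_ , inj₂ (inj₂ refl)) _ t≤2 3<t = ⊥-elim (ℚP.<-asym (ℚP.<-≤-trans 3<t t≤2) 2<3)

module Lex {ℓ : Level} (L : LinOrd ℓ) where
  open LinOrd L
  open IsStrictTotalOrder isStrictTotalOrder using (irrefl; asym) renaming (trans to <-trans)

  _≺_ : Carrier × X → Carrier × X → Set ℓ
  _≺_ = OrdSet._<_ (f L)

  ≺-trans : ∀ {p q r} → p ≺ q → q ≺ r → p ≺ r
  ≺-trans {_ , _} {_ , _} {_ , _} (inj₁ a<b) (inj₁ b<c) = inj₁ (<-trans a<b b<c)
  ≺-trans {_ , _} {_ , _} {_ , _} (inj₁ a<b) (inj₂ (refl , _)) = inj₁ a<b
  ≺-trans {_ , _} {_ , _} {_ , _} (inj₂ (refl , _)) (inj₁ b<c) = inj₁ b<c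
  ≺-trans {_ , _} {_ , _} {_ , _} (inj₂ (refl , s<t)) (inj₂ (refl , t<u)) = inj₂ (refl , ℚP.<-trans s<t t<u)

  lower-snd : ∀ {a x y} z → proj₁ x ℚ.≤ proj₁ y → (a , y) ≺ z → (a , x) ≺ z
  lower-snd (_ , _) _ (inj₁ a<c) = inj₁ a<c
  lower-snd (_ , _) x≤y (inj₂ (refl , y<u)) = inj₂ (refl , ℚP.≤-<-trans x≤y y<u)

  between-fibre : ∀ {a c x t y} → (a , x) ≺ (c , t) → (c , t) ≺ (a , y) →
    (c ≡ a) × (proj₁ x ℚ.< proj₁ t) × (proj₁ t ℚ.< proj₁ y)
  between-fibre (inj₁ a<c) (inj₁ c<a) = ⊥-elim (asym a<c c<a)
  between-fibre (inj₁ a<a) (inj₂ (refl , _)) = ⊥-elim (irrefl refl a<a)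
  between-fibre (inj₂ (refl , _)) (inj₁ a<a) = ⊥-elim (irrefl refl a<a)
  between-fibre (inj₂ (refl , x<t)) (inj₂ (_ , t<y)) = refl , x<t , t<y

  -- The successor of an origin (a , 0) is (a , 1), as X has a gap (0 , 1).
  origin-succ : ∀ a → Succ (f L) (a , x0) (a , x1)
  origin-succ a = inj₂ (refl , 0<1) ,
    λ { (c , t) lo hi → let (_ , 0<t , t<1) = between-fibre {a} {c} {x0} {t} {x1} lo hi in
                        ℚP.<-irrefl refl (ℚP.≤-<-trans (gap01 t 0<t) t<1) }

  no-succ : ∀ a (t : X) → 1ℚ ℚ.≤ proj₁ t → proj₁ t ℚ.< 2ℚ → ∀ s → ¬ Succ (f L) (a , t) s
  no-succ a t 1≤t t<2 (c , u) (inj₁ a<c , empty) =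
    let (m , t<m , _) = dense-above (proj₁ t) x3 1≤t t<2 (ℚP.<-trans t<2 2<3) in
    empty (a , m) (inj₂ (refl , t<m)) (inj₁ a<c)
  no-succ a t 1≤t t<2 (c , u) (inj₂ (refl , t<u) , empty) =
    let (m , t<m , m<u) = dense-above (proj₁ t) u 1≤t t<2 t<u in
    empty (a , m) (inj₂ (refl , t<m)) (inj₂ (refl , m<u))

  no-pred : ∀ a (t : X) → 1ℚ ℚ.< proj₁ t → proj₁ t ℚ.≤ 2ℚ → ∀ p → ¬ Succ (f L) p (a , t)
  no-pred a t 1<t t≤2 (c , u) (inj₁ c<a , empty) =
    let (m , _ , m<t) = dense-below (proj₁ t) x0 1<t t≤2 (ℚP.<-trans 0<1 1<t) in
    empty (a , m) (inj₁ c<a) (inj₂ (refl , m<t))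
  no-pred a t 1<t t≤2 (c , u) (inj₂ (refl , u<t) , empty) =
    let (m , u<m , m<t) = dense-below (proj₁ t) u 1<t t≤2 u<t in
    empty (a , m) (inj₂ (refl , u<m)) (inj₂ (refl , m<t))

  origin-blockStart : ∀ a → BlockStart (f L) (a , x0)
  origin-blockStart a =
    (a , x1) , (a , xMid) , (a , x2) , origin-succ a ,
    inj₂ (refl , 1<xMid) , inj₂ (refl , xMid<2) ,
    λ { (c , t) lo hi → let (c≡a , 1<t , t<2) = between-fibre {a} {c} {x1} {t} {x2} lo hi in
                        subst (λ d → Smooth (f L) (d , t)) (sym c≡a)
                          (no-succ a t (ℚP.<⇒≤ 1<t) t<2 , no-pred a t 1<t (ℚP.<⇒≤ t<2)) }

  -- (a , 2) is not a block start: its successor is (a , 3), and any interval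
  -- ((a , 3) , z) containing a point (e , s) also contains (e , 0), which has a successor.
  two-not-blockStart : ∀ a (x : X) → proj₁ x ≡ 2ℚ → ¬ BlockStart (f L) (a , x)
  two-not-blockStart a x x≡2 ((c , u) , w , z , (inj₁ a<c , empty) , _) =
    empty (a , x3) (inj₂ (refl , subst (ℚ._< 3ℚ) (sym x≡2) 2<3)) (inj₁ a<c)
  two-not-blockStart a x x≡2 ((_ , u) , (e , s) , z , (inj₂ (refl , x<u) , _) , y<w , w<z , smooth)
    with gap23 u (subst (ℚ._< proj₁ u) x≡2 x<u)
  ... | refl with y<w
  ...   | inj₂ (_ , 3<s) = X-max s 3<s
  ...   | inj₁ a<e =
    proj₁ (smooth (e , x0) (inj₁ a<e) (lower-snd {x = x0} {y = s} z (X-min s) w<z)) (e , x1) (origin-succ e)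

  -- (a , 3) is not a block start: its successor is some (c , 0), and any interval
  -- ((c , 0) , z) containing a further point also contains (c , 1), which has a predecessor.
  three-not-blockStart : ∀ a → ¬ BlockStart (f L) (a , x3)
  three-not-blockStart a ((_ , u) , w , z , (inj₂ (refl , 3<u) , _) , _) = X-max u 3<u
  three-not-blockStart a ((c , u) , w , z , (inj₁ a<c , empty) , y<w , w<z , smooth)
    with u | y<w
  ... | (_ , inj₂ (inj₁ (1≤u , _))) | _ = empty (c , x0) (inj₁ a<c) (inj₂ (refl , ℚP.<-≤-trans 0<1 1≤u))
  ... | (_ , inj₂ (inj₂ refl)) | _ = empty (c , x0) (inj₁ a<c) (inj₂ (refl , 0<3))
  ... | (_ , inj₁ refl) | c0<w =
    proj₂ (smooth (c , x1) (inj₂ (refl , 0<1)) (one-below w c0<w w<z)) (c , x0) (origin-succ c)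
    where
      one-below : ∀ w → (c , x0) ≺ w → w ≺ z → (c , x1) ≺ z
      one-below (d , s) (inj₁ c<d) w<z = ≺-trans {c , x1} {d , s} {z} (inj₁ c<d) w<z
      one-below (d , s) (inj₂ (refl , 0<s)) w<z = lower-snd {x = x1} {y = s} z (gap01 s 0<s) w<z

  blockStart⇒origin : ∀ a (x : X) → BlockStart (f L) (a , x) → x ≡ x0
  blockStart⇒origin a (_ , inj₁ refl) _ = refl
  blockStart⇒origin a x@(q , inj₂ (inj₁ (1≤q , q≤2))) start with q ℚ.<? 2ℚ
  ... | yes q<2 = let (y , _ , _ , xy , _) = start in ⊥-elim (no-succ a x 1≤q q<2 y xy)
  ... | no q≮2 = ⊥-elim (two-not-blockStart a x (ℚP.≤-antisym q≤2 (ℚP.≮⇒≥ q≮2)) start)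
  blockStart⇒origin a (_ , inj₂ (inj₂ refl)) start = ⊥-elim (three-not-blockStart a start)

  origin-reflects : ∀ {a a'} → (a , x0) ≺ (a' , x0) → a < a'
  origin-reflects (inj₁ a<a') = a<a'
  origin-reflects (inj₂ (_ , 0<0)) = ⊥-elim (ℚP.<-irrefl refl 0<0)

lex-cong : ∀ {a b} (L₁ : LinOrd a) (L₂ : LinOrd b) → toOrdSet L₁ ≅ toOrdSet L₂ → f L₁ ≅ f L₂
lex-cong L₁ L₂ φ =
  mk↔ₛ′ (λ (a , x) → to a , x) (λ (b , y) → from b , y)
        (λ (b , y) → cong (_, y) (strictlyInverseˡ b))
        (λ (a , x) → cong (_, x) (strictlyInverseʳ a)) ,
  λ { (a , x) (a' , x') →
      (λ { (inj₁ a<a') → inj₁ (preserves a<a') ; (inj₂ (refl , x<x')) → inj₂ (refl , x<x') }) ,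
      (λ { (inj₁ a<a') → inj₁ (reflects a<a') ; (inj₂ (eq , x<x')) → inj₂ (to-injective eq , x<x') }) }
  where
    open Iso (toOrdSet L₁) (toOrdSet L₂) φ
    to-injective : ∀ {a a'} → to a ≡ to a' → a ≡ a'
    to-injective {a} {a'} eq = trans (sym (strictlyInverseʳ a)) (trans (cong from eq) (strictlyInverseʳ a'))

origins-preserved : ∀ {a b} (L₁ : LinOrd a) (L₂ : LinOrd b) (φ : f L₁ ≅ f L₂) →
  ∀ c → proj₂ (Iso.to (f L₁) (f L₂) φ (c , x0)) ≡ x0
origins-preserved L₁ L₂ φ c =
  Lex.blockStart⇒origin L₂ _ _ (BlockStart-preserved {A = f L₁} {f L₂} φ (Lex.origin-blockStart L₁ c))

restrict-to-origins : ∀ {a b} (L₁ : LinOrd a) (L₂ : LinOrd b) (φ : f L₁ ≅ f L₂) →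
  (∀ c → proj₂ (Iso.to (f L₁) (f L₂) φ (c , x0)) ≡ x0) →
  (∀ d → proj₂ (Iso.from (f L₁) (f L₂) φ (d , x0)) ≡ x0) →
  toOrdSet L₁ ≅ toOrdSet L₂
restrict-to-origins L₁ L₂ φ to-origin from-origin =
  mk↔ₛ′ g h g∘h h∘g ,
  λ c c' → (λ c<c' → Lex.origin-reflects L₂
                        (subst₂ (OrdSet._<_ (f L₂)) (g-origin c) (g-origin c') (preserves (inj₁ c<c')))) ,
           (λ gc<gc' → Lex.origin-reflects L₁
                        (reflects (subst₂ (OrdSet._<_ (f L₂)) (sym (g-origin c)) (sym (g-origin c')) (inj₁ gc<gc'))))
  where
    open Iso (f L₁) (f L₂) φ
    g : LinOrd.Carrier L₁ → LinOrd.Carrier L₂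
    g c = proj₁ (to (c , x0))
    h : LinOrd.Carrier L₂ → LinOrd.Carrier L₁
    h d = proj₁ (from (d , x0))
    at-origin : ∀ {ℓ} {C : Set ℓ} (p : C × X) → proj₂ p ≡ x0 → p ≡ (proj₁ p , x0)
    at-origin (_ , _) refl = refl
    g-origin : ∀ c → to (c , x0) ≡ (g c , x0)
    g-origin c = at-origin (to (c , x0)) (to-origin c)
    h-origin : ∀ d → from (d , x0) ≡ (h d , x0)
    h-origin d = at-origin (from (d , x0)) (from-origin d)
    g∘h : ∀ d → g (h d) ≡ d
    g∘h d = cong proj₁ (trans (cong to (sym (h-origin d))) (strictlyInverseˡ (d , x0)))
    h∘g : ∀ c → h (g c) ≡ c
    h∘g c = cong proj₁ (trans (cong from (sym (g-origin c))) (strictlyInverseʳ (c , x0)))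

mainTheorem15 : ∀ {a b : Level} (L₁ : LinOrd a) (L₂ : LinOrd b) →
    ((toOrdSet L₁ ≅ toOrdSet L₂) → (f L₁ ≅ f L₂)) × ((f L₁ ≅ f L₂) → (toOrdSet L₁ ≅ toOrdSet L₂))
mainTheorem15 L₁ L₂ =
  lex-cong L₁ L₂ ,
  λ φ → restrict-to-origins L₁ L₂ φ (origins-preserved L₁ L₂ φ) (origins-preserved L₂ L₁ (≅-sym φ))
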